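{- For every integer $m\ge1$ and every term $w=w_1\otimes\cdots\otimes w_{m+1}$ of $X\cdot P^m\cdot X\in B^{\otimes(m+1)}$, there exists an integer $k\ge0$ such that $w_1=\cdots=w_k=X$ and $w_{k+1}=Z$, and there exists an integer $\ell\ge0$ such that $w_{m+1}=\cdots=w_{m+2-\ell}=X$ and $w_{m+1-\ell}=Z$. That is, $w$ begins with $k$ copies of $X$ followed by $Z$ and ends with $Z$ followed by $\ell$ copies of $X$.
   Context: Let $\mathcal M=\mathbb Z\langle y,n\rangle/(yn=ny=n,\ n^2=0,\ y^2=y)$. In the ring $\mathcal M\otimes\mathcal M$ (tensor over $\mathbb Z$, with $(a\otimes b)(c\otimes d)=ac\otimes bd$) put $X=y\otimes n+n\otimes y$, $Y=y\otimes y$, $Z=n\otimes n$, and let $B$ be the $\mathbb Z$-span of $X,Y,Z$: a commutative subring, free abelian with basis $X,Y,Z$, with $X^2=2Z$, $Y^2=Y$, $Z^2=0$, $XY=YX=X$, $XZ=ZX=0$, $YZ=ZY=Z$. For $r\ge1$, $B^{\otimes r}$ is free abelian with basis the words $w_1\otimes\cdots\otimes w_r$, $w_i\in\{X,Y,Z\}$; writing $u\in B^{\otimes r}$ uniquely as $\sum_w c_w w$, a term of $u$ is a word $w$ with $c_w\ne0$, and $c_w$ is its coefficient. The chaining product $B^{\otimes r}\times B^{\otimes s}\to B^{\otimes(r+s-1)}$ is the bilinear (associative) map $(a_1\otimes\cdots\otimes a_r)\cdot(b_1\otimes\cdots\otimes b_s)=a_1\otimes\cdots\otimes a_{r-1}\otimes(a_rb_1)\otimes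 b_2\otimes\cdots\otimes b_s$. Elements of $B$ are regarded as elements of $B^{\otimes1}$. Let $P=X\otimes Y+Y\otimes X\in B^{\otimes2}$ and let $P^m\in B^{\otimes(m+1)}$ be its $m$-fold chaining product. -}

module Defs where

open import Data.Nat using (ℕ; zero; suc; _+_)
open import Data.Nat.Properties using (+-comm)
open import Data.Integer using (ℤ; +_; _*_; 0ℤ) renaming (_+_ to _+ℤ_)
open import Data.Product using (_×_; _,_)
open import Data.List using (List; []; _∷_; concatMap; map)
open import Data.Vec using (Vec; []; _∷_; _++_; cast; [_])
open import Relation.Nullary using (Dec; yes; no)
open import Relation.Binary.PropositionalEquality using (_≡_; _≢_; refl)
open import Data.Vec.Properties using (≡-dec)

data Letter : Set where
  X Y Z : Letter

_≟L_ : (a b : Letter) → Dec (a ≡ b)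
X ≟L X = yes refl
X ≟L Y = no λ ()
X ≟L Z = no λ ()
Y ≟L X = no λ ()
Y ≟L Y = yes refl
Y ≟L Z = no λ ()
Z ≟L X = no λ ()
Z ≟L Y = no λ ()
Z ≟L Z = yes refl

-- An element of B^{⊗r} as a formal ℤ-linear combination of words (a list
-- of (coefficient, word) pairs); its actual coefficients are given by 'coeff'.
Tensor : ℕ → Set
Tensor r = List (ℤ × Vec Letter r)

mulL : Letter → Letter → List (ℤ × Letter)
mulL X X = (+ 2 , Z) ∷ []
mulL X Y = (+ 1 , X) ∷ []
mulL X Z = []
mulL Y X = (+ 1 , X) ∷ []
mulL Y Y = (+ 1 , Y) ∷ []
mulL Y Z = (+ 1 , Z) ∷ []
mulL Z X = []
mulL Z Y = (+ 1 , Z) ∷ []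
mulL Z Z = []

chainW : ∀ {r s} → Vec Letter (suc r) → Vec Letter (suc s) → Tensor (r + suc s)
chainW {zero} (a ∷ []) (b ∷ bs) = map (λ { (c , l) → (c , l ∷ bs) }) (mulL a b)
chainW {suc r} (a ∷ as) bs = map (λ { (c , w) → (c , a ∷ w) }) (chainW {r} as bs)

_·_ : ∀ {r s} → Tensor (suc r) → Tensor (suc s) → Tensor (r + suc s)
u · v = concatMap (λ { (c , a) →
          concatMap (λ { (d , b) → map (λ { (e , w) → (c * d * e , w) }) (chainW a b) }) v }) u

coeff : ∀ {r} → Tensor r → Vec Letter r → ℤ
coeff [] w = 0ℤ
coeff ((c , w') ∷ u) w with ≡-dec _≟L_ w' w
... | yes _ = c +ℤ coeff u w
... | no _ = coeff u w

IsTerm : ∀ {r} → Tensor r → Vec Letter r → Set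
IsTerm u w = coeff u w ≢ 0ℤ

Xt : Tensor 1
Xt = (+ 1 , X ∷ []) ∷ []

P : Tensor 2
P = (+ 1 , X ∷ Y ∷ []) ∷ (+ 1 , Y ∷ X ∷ []) ∷ []

-- P^m ∈ B^{⊗(m+1)} for m ≥ 1 (indexed by m' = m - 1): P^1 = P, P^{m+1} = P · P^m.
Ppow : (m' : ℕ) → Tensor (suc (suc m'))
Ppow zero = P
Ppow (suc m') = P · Ppow m'

castT : ∀ {r s} → .(r ≡ s) → Tensor r → Tensor s
castT eq = map (λ { (c , w) → (c , cast eq w) })

-- X · P^m · X ∈ B^{⊗(m+1)} for m = suc m'.
XPX : (m' : ℕ) → Tensor (suc (suc m'))
XPX m' = castT (+-comm (suc m') 1) ((Xt · Ppow m') · Xt)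

{-# OPTIONS --safe #-}
-- Choose a summand X⊗Y or Y⊗X of P at each of the m factors of X·P^m·X, and
-- read the outer X's as the tail of a Y⊗X on the left and the head of an X⊗Y
-- on the right.  Then every term of X·P^m·X is the word of junction letters
-- of a walk s₀ = Y⊗X, s₁, …, sₘ, sₘ₊₁ = X⊗Y: the letter between sᵢ and sᵢ₊₁
-- is X when they agree, Z for Y⊗X then X⊗Y, and Y for X⊗Y then Y⊗X.  The walk
-- stays at Y⊗X for a while (letters X) and must switch to X⊗Y (letter Z);
-- symmetrically, its final run at X⊗Y (letters X) is preceded by a switch
-- from Y⊗X (letter Z).
module Submission where

open import Data.Nat using (ℕ; zero; suc; _+_; _<_; _≤_; s≤s; s≤s⁻¹)
open import Data.Nat.Properties using (<⇒≱; 1+n≰n; m<n⇒m<1+n; m≤n+m; suc-injective; +-comm)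
open import Data.Fin using (Fin; toℕ; zero; suc)
open import Data.Vec using (Vec; lookup; []; _∷_)
open import Data.Vec.Properties using (cast-is-id; ≡-dec)
import Data.Vec.Relation.Unary.All as VecAll
open import Data.Vec.Relation.Unary.All.Properties using (lookup⁺)
open import Data.List using (List)
open import Data.List.Relation.Unary.All as All using (All; []; _∷_)
open import Data.List.Relation.Unary.All.Properties using (map⁺; concat⁺)
open import Data.Product using (Σ; _×_; _,_; proj₂)
open import Data.Sum using (_⊎_; inj₁; inj₂)
open import Data.Empty using (⊥-elim)
open import Function using (_∘_)
open import Relation.Nullary using (yes; no)
open import Relation.Binary.PropositionalEquality using (_≡_; refl; sym; cong; subst)
open import Defs

private
  variable
    m n r₁ r₂ : ℕ

AllWords : (Vec Letter n → Set) → Tensor n → Set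
AllWords Q = All (Q ∘ proj₂)

AllWords-IsTerm : {Q : Vec Letter n → Set} {u : Tensor n} {w : Vec Letter n}
  → AllWords Q u → IsTerm u w → Q w
AllWords-IsTerm {u = List.[]} [] nonzero = ⊥-elim (nonzero refl)
AllWords-IsTerm {u = (c , w′) List.∷ u} {w} (q ∷ qs) nonzero with ≡-dec _≟L_ w′ w
... | yes refl = q
... | no _ = AllWords-IsTerm qs nonzero

AllWords-· : {Q : Vec Letter (suc r₁) → Set} {R : Vec Letter (suc r₂) → Set}
  {S : Vec Letter (r₁ + suc r₂) → Set} {u : Tensor (suc r₁)} {v : Tensor (suc r₂)}
  → (∀ {x y} → Q x → R y → AllWords S (chainW x y))
  → AllWords Q u → AllWords R v → AllWords S (u · v)
AllWords-· chain qs rs =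
  concat⁺ (map⁺ (All.map (λ q → concat⁺ (map⁺ (All.map (map⁺ ∘ chain q) rs))) qs))

AllWords-castT : (Q : ∀ {n} → Vec Letter n → Set) (eq : m ≡ n) {u : Tensor m}
  → AllWords Q u → AllWords Q (castT eq u)
AllWords-castT Q refl = map⁺ ∘ All.map (λ {(_ , w)} → subst Q (sym (cast-is-id refl w)))

data Summand : Set where
  xy yx : Summand

left right : Summand → Letter
left xy = X
left yx = Y
right xy = Y
right yx = X

-- right s · left t, up to the coefficient 2 of X·X = 2Z
junction : Summand → Summand → Letter
junction xy xy = X
junction xy yx = Y
junction yx xy = Z
junction yx yx = X

chainW-junction : ∀ s t {Q : Vec Letter (suc n) → Set} (w : Vec Letter n)
  → Q (junction s t ∷ w) → AllWords Q (chainW (right s ∷ []) (left t ∷ w))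
chainW-junction xy xy w q = q ∷ []
chainW-junction xy yx w q = q ∷ []
chainW-junction yx xy w q = q ∷ []
chainW-junction yx yx w q = q ∷ []

data Walk : Summand → Summand → Vec Letter n → Set where
  []   : ∀ {s} → Walk s s []
  step : ∀ {s t u} {w : Vec Letter n} → Walk t u w → Walk s u (junction s t ∷ w)

-- The word of P^m for the summands s = s₁, …, sₘ, without its first letter left s₁.
data OpenWalk : Summand → Vec Letter (suc n) → Set where
  end  : ∀ {s} → OpenWalk {zero} s (right s ∷ [])
  step : ∀ {s t} {w : Vec Letter (suc n)} → OpenWalk t w → OpenWalk s (junction s t ∷ w)

data PᵐWord : Vec Letter (suc (suc n)) → Set where
  word : ∀ s {w : Vec Letter (suc n)} → OpenWalk s w → PᵐWord (left s ∷ w)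

PᵐWord-P : AllWords PᵐWord P
PᵐWord-P = word xy end ∷ word yx end ∷ []

PᵐWord-chainW : ∀ s {v : Vec Letter (suc (suc n))}
  → PᵐWord v → AllWords PᵐWord (chainW (left s ∷ right s ∷ []) v)
PᵐWord-chainW s (word t {w} open-walk) = map⁺ (chainW-junction s t w (word s (step open-walk)))

PᵐWord-Ppow : ∀ m → AllWords PᵐWord (Ppow m)
PᵐWord-Ppow zero = PᵐWord-P
PᵐWord-Ppow (suc m) = AllWords-· (λ { (s , refl) → PᵐWord-chainW s }) summands (PᵐWord-Ppow m)
  where
  summands : AllWords (λ x → Σ Summand λ s → x ≡ left s ∷ right s ∷ []) P
  summands = (xy , refl) ∷ (yx , refl) ∷ []

OpenWalk-Xt·Ppow : ∀ m → AllWords (OpenWalk yx) (Xt · Ppow m)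
OpenWalk-Xt·Ppow m = AllWords-· {Q = _≡ X ∷ []} {u = Xt}
  (λ { refl (word t {w} open-walk) → chainW-junction yx t w (step open-walk) })
  (refl ∷ []) (PᵐWord-Ppow m)

Walk-chainW-X : ∀ {s} {w : Vec Letter (suc n)}
  → OpenWalk s w → AllWords (Walk s xy) (chainW w (X ∷ []))
Walk-chainW-X {s = s} end = chainW-junction s xy [] (step [])
Walk-chainW-X (step open-walk) = map⁺ (All.map step (Walk-chainW-X open-walk))

Walk-XPX : ∀ m → AllWords (Walk yx xy) (XPX m)
Walk-XPX m = AllWords-castT (Walk yx xy) (+-comm (suc m) 1)
  (AllWords-· {R = _≡ X ∷ []} {v = Xt} (λ { open-walk refl → Walk-chainW-X open-walk })
    (OpenWalk-Xt·Ppow m) (refl ∷ []))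

HasPrefixXᵏZ : ℕ → Vec Letter n → Set
HasPrefixXᵏZ {n} k w = ((i : Fin n) → toℕ i < k → lookup w i ≡ X)
                     × Σ (Fin n) (λ j → toℕ j ≡ k × lookup w j ≡ Z)

HasSuffixZXˡ : ℕ → Vec Letter n → Set
HasSuffixZXˡ {n} ℓ w = ((i : Fin n) → n ≤ toℕ i + ℓ → lookup w i ≡ X)
                     × Σ (Fin n) (λ j → suc (toℕ j + ℓ) ≡ n × lookup w j ≡ Z)

Z∷-HasPrefixXᵏZ : (w : Vec Letter n) → HasPrefixXᵏZ 0 (Z ∷ w)
Z∷-HasPrefixXᵏZ w = (λ _ ()) , zero , refl , refl

X∷-HasPrefixXᵏZ : ∀ {k} {w : Vec Letter n} → HasPrefixXᵏZ k w → HasPrefixXᵏZ (suc k) (X ∷ w)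
X∷-HasPrefixXᵏZ (xs , j , j≡k , z) = xs′ , suc j , cong suc j≡k , z
  where
  xs′ : ∀ i → toℕ i < suc _ → lookup (X ∷ _) i ≡ X
  xs′ zero _ = refl
  xs′ (suc i) 1+i<1+k = xs i (s≤s⁻¹ 1+i<1+k)

Z∷Xⁿ-HasSuffixZXˡ : {w : Vec Letter n} → VecAll.All (_≡ X) w → HasSuffixZXˡ n (Z ∷ w)
Z∷Xⁿ-HasSuffixZXˡ {n} allX = xs , zero , refl , refl
  where
  xs : ∀ i → suc n ≤ toℕ i + n → lookup (Z ∷ _) i ≡ X
  xs zero n<n = ⊥-elim (1+n≰n n<n)
  xs (suc i) _ = lookup⁺ allX i

∷-HasSuffixZXˡ : ∀ {ℓ} c {w : Vec Letter n} → HasSuffixZXˡ ℓ w → HasSuffixZXˡ ℓ (c ∷ w)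
∷-HasSuffixZXˡ {n} {ℓ} c (xs , j , 1+j+ℓ≡n , z) = xs′ , suc j , cong suc 1+j+ℓ≡n , z
  where
  ℓ<n : ℓ < n
  ℓ<n = subst (ℓ <_) 1+j+ℓ≡n (s≤s (m≤n+m ℓ (toℕ j)))

  xs′ : ∀ i → suc n ≤ toℕ i + ℓ → lookup (c ∷ _) i ≡ X
  xs′ zero n<ℓ = ⊥-elim (<⇒≱ (m<n⇒m<1+n ℓ<n) n<ℓ)
  xs′ (suc i) n≤i+ℓ = xs i (s≤s⁻¹ n≤i+ℓ)

Walk-HasPrefixXᵏZ : {w : Vec Letter n} → Walk yx xy w → Σ ℕ λ k → HasPrefixXᵏZ k w
Walk-HasPrefixXᵏZ (step {t = xy} {w = w} _) = 0 , Z∷-HasPrefixXᵏZ w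
Walk-HasPrefixXᵏZ (step {t = yx} walk) with Walk-HasPrefixXᵏZ walk
... | k , prefix = suc k , X∷-HasPrefixXᵏZ prefix

Walk⇒AllX⊎HasSuffixZXˡ : ∀ {s} {w : Vec Letter n} → Walk s xy w
  → (s ≡ xy × VecAll.All (_≡ X) w) ⊎ Σ ℕ λ ℓ → HasSuffixZXˡ ℓ w
Walk⇒AllX⊎HasSuffixZXˡ [] = inj₁ (refl , VecAll.[])
Walk⇒AllX⊎HasSuffixZXˡ (step {s = s} {t = t} walk) with Walk⇒AllX⊎HasSuffixZXˡ walk
... | inj₂ (ℓ , suffix) = inj₂ (ℓ , ∷-HasSuffixZXˡ (junction s t) suffix)
Walk⇒AllX⊎HasSuffixZXˡ (step {s = xy} walk) | inj₁ (refl , allX) = inj₁ (refl , refl VecAll.∷ allX)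
Walk⇒AllX⊎HasSuffixZXˡ (step {s = yx} walk) | inj₁ (refl , allX) = inj₂ (_ , Z∷Xⁿ-HasSuffixZXˡ allX)

Walk-HasSuffixZXˡ : {w : Vec Letter n} → Walk yx xy w → Σ ℕ λ ℓ → HasSuffixZXˡ ℓ w
Walk-HasSuffixZXˡ walk with Walk⇒AllX⊎HasSuffixZXˡ walk
... | inj₂ suffix = suffix

lemma4p5 : (m' : ℕ) (w : Vec Letter (suc (suc m')))
    → IsTerm (XPX m') w
    → Σ ℕ (λ k → ((i : Fin (suc (suc m'))) → toℕ i < k → lookup w i ≡ X)
                × Σ (Fin (suc (suc m'))) (λ j → toℕ j ≡ k × lookup w j ≡ Z))
      × Σ ℕ (λ ℓ → ((i : Fin (suc (suc m'))) → suc m' < toℕ i + ℓ → lookup w i ≡ X)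
                × Σ (Fin (suc (suc m'))) (λ j → toℕ j + ℓ ≡ suc m' × lookup w j ≡ Z))
lemma4p5 m' w term =
  let walk = AllWords-IsTerm (Walk-XPX m') term
      ℓ , xs , j , 1+j+ℓ≡n , z = Walk-HasSuffixZXˡ walk
  in Walk-HasPrefixXᵏZ walk , ℓ , xs , j , suc-injective 1+j+ℓ≡n , z
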